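{- Let $n$ be an even positive integer and let $1=a_1<a_2<\cdots<a_k=n$ be all the positive divisors of $n$. If $a_{i+1}\le 2a_i$ for all $1\le i\le k-1$ and $\sigma(n)$ is even, then $n$ is a half-Zumkeller number.
   Context: $\sigma(n)$ denotes the sum of all positive divisors of $n$. A positive integer $n$ is a half-Zumkeller number if the set of all positive divisors of $n$ other than $n$ itself can be partitioned into two disjoint parts whose sums are equal. -}

module Defs where

open import Data.Nat using (ℕ; zero; suc; _+_; _*_; _∸_; _≤_)
open import Data.Nat.Divisibility using (_∣_; _∣?_)
open import Data.List using (List; []; _∷_; filter; map; upTo; length)
open import Data.Nat.ListAction using (sum)
open import Data.List.Relation.Unary.Linked using (Linked)
open import Data.Bool using (Bool; true; false; if_then_else_)
open import Data.Product using (Σ; _×_)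
open import Relation.Binary.PropositionalEquality using (_≡_)

range1 : ℕ → List ℕ
range1 n = map suc (upTo n)

divisors : ℕ → List ℕ
divisors n = filter (λ d → d ∣? n) (range1 n)

properDivisors : ℕ → List ℕ
properDivisors n = filter (λ d → d ∣? n) (range1 (n ∸ 1))

σ : ℕ → ℕ
σ n = sum (divisors n)

GapCondition : ℕ → Set
GapCondition n = Linked (λ a b → b ≤ 2 * a) (divisors n)

eqB : Bool → Bool → Bool
eqB true  true  = true
eqB false false = true
eqB _     _     = false

partSum : Bool → List ℕ → List Bool → ℕ
partSum b []       _        = 0
partSum b (x ∷ xs) []       = 0
partSum b (x ∷ xs) (c ∷ cs) = (if eqB b c then x else 0) + partSum b xs cs

-- A partition of a (duplicate-free) list into two disjoint parts with equal sums:
-- each element is assigned to part "true" or part "false".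
EqualSumPartition : List ℕ → Set
EqualSumPartition xs =
  Σ (List Bool) λ labels →
    (length labels ≡ length xs) × (partSum true xs labels ≡ partSum false xs labels)

HalfZumkeller : ℕ → Set
HalfZumkeller n = EqualSumPartition (properDivisors n)

module Submission where

-- Call a list x₁, x₂, … of naturals P-complete when every
-- element is at most one more than P plus the sum of the elements before it.
-- For such a list, every t ≤ P + Σ xᵢ is a subset sum up to an error u ≤ P
-- (decide greedily, last element first, whether xᵢ is needed); for P = 0
-- every t ≤ Σ xᵢ is an exact subset sum, so a 0-complete list with even sum
-- splits into two parts of equal sum (take a subset summing to half).
--
-- A list starting below 1 + P in which consecutive elements satisfy
-- b ≤ 2a is P-complete, because 2a ≤ a + (1 + P + sum before a).  The proper
-- divisors of an even n ≥ 2 start with 1, inherit the gap condition from the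
-- full divisor list (which is the proper divisors followed by n), and have
-- even sum σ(n) − n; hence they form a 0-complete list with even sum, and n
-- is half-Zumkeller.

open import Defs
open import Data.Nat using (ℕ; _≤_)
open import Data.Nat.Divisibility using (_∣_)

open import Data.Nat using (zero; suc; _+_; _*_; _∸_; _≤?_; z≤n)
open import Data.Nat.Properties
open import Data.Nat.Divisibility using (_∣?_; divides; ∣-refl; 1∣_; ∣m+n∣m⇒∣n; ∣1⇒≡1)
open import Data.List using (List; []; _∷_; _++_; map; filter; upTo; length; [_])
open import Data.List.Properties using (filter-accept; filter-++; map-++; upTo-∷ʳ)
open import Data.Nat.ListAction using (sum)
open import Data.Nat.ListAction.Properties using (sum-++)
open import Data.List.Relation.Unary.Linked using (Linked; []; [-]; _∷_)
open import Data.Bool using (Bool; true; false)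
open import Data.Product using (Σ; ∃; _×_; _,_)
open import Relation.Nullary using (yes; no)
open import Relation.Binary.PropositionalEquality hiding ([_])

Doubling : ℕ → ℕ → Set
Doubling a b = b ≤ 2 * a

data Complete : ℕ → List ℕ → Set where
  []  : ∀ {P} → Complete P []
  _∷_ : ∀ {P x xs} → x ≤ suc P → Complete (P + x) xs → Complete P (x ∷ xs)

double-bound : ∀ {P x} → x ≤ suc P → 2 * x ≤ suc (P + x)
double-bound {P} {x} x≤1+P = begin
  2 * x         ≡⟨ cong (x +_) (+-identityʳ x) ⟩
  x + x         ≤⟨ +-monoʳ-≤ x x≤1+P ⟩
  x + suc P     ≡⟨ +-suc x P ⟩
  suc (x + P)   ≡⟨ cong suc (+-comm x P) ⟩
  suc (P + x)   ∎
  where open ≤-Reasoning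

doubling⇒complete : ∀ {P x xs} → Linked Doubling (x ∷ xs) → x ≤ suc P → Complete P (x ∷ xs)
doubling⇒complete [-]           x≤1+P = x≤1+P ∷ []
doubling⇒complete (y≤2x ∷ gaps) x≤1+P =
  x≤1+P ∷ doubling⇒complete gaps (≤-trans y≤2x (double-bound x≤1+P))

record Approx (P : ℕ) (xs : List ℕ) (t : ℕ) : Set where
  field
    labels     : List Bool
    length-ok  : length labels ≡ length xs
    error      : ℕ
    error≤P    : error ≤ P
    decomposes : t ≡ error + partSum true xs labels

-- Every t ≤ P + sum xs is approximable within P when xs is P-complete:
-- approximate t in the tail with error u ≤ P + x, and take x exactly when u > P.
complete⇒approx : ∀ {P xs} → Complete P xs → ∀ t → t ≤ P + sum xs → Approx P xs t
complete⇒approx {P} [] t t≤ = record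
  { labels = [] ; length-ok = refl ; error = t
  ; error≤P = ≤-trans t≤ (≤-reflexive (+-identityʳ P))
  ; decomposes = sym (+-identityʳ t) }
complete⇒approx {P} {x ∷ xs} (x≤1+P ∷ rest) t t≤
  with complete⇒approx rest t (≤-trans t≤ (≤-reflexive (sym (+-assoc P x (sum xs)))))
... | record { labels = ls ; length-ok = len ; error = u ; error≤P = u≤P+x ; decomposes = t≡ }
  with u ≤? P
... | yes u≤P = record
  { labels = false ∷ ls ; length-ok = cong suc len ; error = u ; error≤P = u≤P ; decomposes = t≡ }
... | no u≰P = record
  { labels = true ∷ ls ; length-ok = cong suc len ; error = u ∸ x
  ; error≤P = m≤n+o⇒m∸n≤o u x (≤-trans u≤P+x (≤-reflexive (+-comm P x)))
  ; decomposes = begin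
      t                                    ≡⟨ t≡ ⟩
      u + partSum true xs ls               ≡⟨ cong (_+ partSum true xs ls) (sym (m∸n+n≡m x≤u)) ⟩
      (u ∸ x) + x + partSum true xs ls     ≡⟨ +-assoc (u ∸ x) x _ ⟩
      (u ∸ x) + (x + partSum true xs ls)   ∎ }
  where
  open ≡-Reasoning
  x≤u : x ≤ u
  x≤u = ≤-trans x≤1+P (≰⇒> u≰P)

complete⇒subsetSum : ∀ {xs} → Complete 0 xs → ∀ t → t ≤ sum xs →
  Σ (List Bool) λ ls → (length ls ≡ length xs) × (partSum true xs ls ≡ t)
complete⇒subsetSum {xs} c t t≤ with complete⇒approx c t t≤
... | record { labels = ls ; length-ok = len ; error = .0 ; error≤P = z≤n ; decomposes = t≡ } =
  ls , len , sym t≡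

partSum-complement : ∀ xs ls → length ls ≡ length xs →
  partSum true xs ls + partSum false xs ls ≡ sum xs
partSum-complement [] [] _ = refl
partSum-complement (x ∷ xs) (true ∷ ls) len =
  trans (+-assoc x (partSum true xs ls) (partSum false xs ls))
        (cong (x +_) (partSum-complement xs ls (suc-injective len)))
partSum-complement (x ∷ xs) (false ∷ ls) len =
  trans (+-exchange (partSum true xs ls) x (partSum false xs ls))
        (cong (x +_) (partSum-complement xs ls (suc-injective len)))
  where
  +-exchange : ∀ a b c → a + (b + c) ≡ b + (a + c)
  +-exchange a b c = trans (sym (+-assoc a b c)) (trans (cong (_+ c) (+-comm a b)) (+-assoc b a c))

-- A 0-complete list with even sum splits into two parts of equal sum:
-- pick a subset summing to half; its complement sums to the other half.
complete⇒equalSumPartition : ∀ {xs} → Complete 0 xs → 2 ∣ sum xs → EqualSumPartition xs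
complete⇒equalSumPartition {xs} c (divides q sum≡q*2)
  with complete⇒subsetSum c q (≤-trans (m≤m+n q (q + 0)) (≤-reflexive (trans (*-comm 2 q) (sym sum≡q*2))))
... | ls , len , true≡q = ls , len , trans true≡q (sym false≡q)
  where
  open ≡-Reasoning
  false≡q : partSum false xs ls ≡ q
  false≡q = +-cancelˡ-≡ q _ _ (begin
    q + partSum false xs ls                   ≡⟨ cong (_+ partSum false xs ls) (sym true≡q) ⟩
    partSum true xs ls + partSum false xs ls  ≡⟨ partSum-complement xs ls len ⟩
    sum xs                                    ≡⟨ sum≡q*2 ⟩
    q * 2                                     ≡⟨ *-comm q 2 ⟩
    q + (q + 0)                               ≡⟨ cong (q +_) (+-identityʳ q) ⟩
    q + q                                     ∎)

linked-++⁻ˡ : ∀ {R : ℕ → ℕ → Set} xs {ys} → Linked R (xs ++ ys) → Linked R xs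
linked-++⁻ˡ []           _          = []
linked-++⁻ˡ (x ∷ [])     _          = [-]
linked-++⁻ˡ (x ∷ y ∷ xs) (r ∷ rest) = r ∷ linked-++⁻ˡ (y ∷ xs) rest

divisors≡properDivisors++n : ∀ m → divisors (suc m) ≡ properDivisors (suc m) ++ [ suc m ]
divisors≡properDivisors++n m = begin
  filter (_∣? suc m) (map suc (upTo (suc m)))
    ≡⟨ cong (λ l → filter (_∣? suc m) (map suc l)) (sym (upTo-∷ʳ m)) ⟩
  filter (_∣? suc m) (map suc (upTo m ++ [ m ]))
    ≡⟨ cong (filter (_∣? suc m)) (map-++ suc (upTo m) [ m ]) ⟩
  filter (_∣? suc m) (map suc (upTo m) ++ [ suc m ])
    ≡⟨ filter-++ (_∣? suc m) (map suc (upTo m)) [ suc m ] ⟩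
  properDivisors (suc m) ++ filter (_∣? suc m) [ suc m ]
    ≡⟨ cong (properDivisors (suc m) ++_) (filter-accept (_∣? suc m) ∣-refl) ⟩
  properDivisors (suc m) ++ [ suc m ] ∎
  where open ≡-Reasoning

σ≡sumProper+n : ∀ m → σ (suc m) ≡ sum (properDivisors (suc m)) + suc m
σ≡sumProper+n m = begin
  sum (divisors (suc m))                                       ≡⟨ cong sum (divisors≡properDivisors++n m) ⟩
  sum (properDivisors (suc m) ++ [ suc m ])                    ≡⟨ sum-++ (properDivisors (suc m)) [ suc m ] ⟩
  sum (properDivisors (suc m)) + (suc m + 0)                   ≡⟨ cong (sum (properDivisors (suc m)) +_) (+-identityʳ (suc m)) ⟩
  sum (properDivisors (suc m)) + suc m                         ∎
  where open ≡-Reasoning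

properDivisors-head : ∀ k → ∃ λ ds → properDivisors (suc (suc k)) ≡ 1 ∷ ds
properDivisors-head k = _ , filter-accept (_∣? suc (suc k)) (1∣ (suc (suc k)))

properDivisors-complete : ∀ k → GapCondition (suc (suc k)) → Complete 0 (properDivisors (suc (suc k)))
properDivisors-complete k gap with properDivisors-head k
... | ds , proper≡1∷ds = subst (Complete 0) (sym proper≡1∷ds)
  (doubling⇒complete (subst (Linked Doubling) proper≡1∷ds gapProper) ≤-refl)
  where
  gapProper : Linked Doubling (properDivisors (suc (suc k)))
  gapProper = linked-++⁻ˡ (properDivisors (suc (suc k)))
                (subst (Linked Doubling) (divisors≡properDivisors++n (suc k)) gap)

mainTheorem18 : (n : ℕ) → 1 ≤ n → 2 ∣ n → GapCondition n → 2 ∣ σ n → HalfZumkeller n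
mainTheorem18 (suc zero) _ 2∣1 _ _ with ∣1⇒≡1 2∣1
... | ()
mainTheorem18 (suc (suc k)) _ 2∣n gap 2∣σ =
  complete⇒equalSumPartition (properDivisors-complete k gap) 2∣sumProper
  where
  2∣sumProper : 2 ∣ sum (properDivisors (suc (suc k)))
  2∣sumProper = ∣m+n∣m⇒∣n (subst (2 ∣_) (trans (σ≡sumProper+n (suc k)) (+-comm _ (suc (suc k)))) 2∣σ) 2∣n
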